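{- For all integers $m,k\ge1$, the vector $(m,2,k,1)$ is not 0-realizable.
   Context: All graphs are finite, nonempty, simple and reflexive. Corner ranking: $N[v]$ is the closed neighborhood. In a graph $H$, $w$ strictly corners a distinct vertex $v$ if $N[v]\subsetneq N[w]$. Set $G^{(1)}=G$, $k=1$. If $G^{(k)}$ is a clique, give its vertices rank $k$ and stop; else if it has no strict corners, give its vertices rank $\infty$ and stop; else give all strict corners of $G^{(k)}$ rank $k$, delete them to get $G^{(k+1)}$, increase $k$, repeat. The corner rank $\alpha$ is the largest vertex rank; cop-win graphs are those with finite corner rank. $G$ is of type 0 unless some (equivalently every) vertex of rank $\alpha$ is adjacent to all vertices of $G^{(\alpha-1)}$. The rank cardinality vector of $G$ is $(x_\alpha,\ldots,x_1)$, $x_k$ the number of vertices of rank $k$. A vector of positive integers is 0-realizable if it is the rank cardinality vector of some cop-win graph of type 0. -}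

module Defs where

open import Data.Nat using (ℕ; zero; suc; pred; _+_; _<_; _≤_)
open import Data.Bool using (Bool; true; false; _∧_; _∨_; not; if_then_else_)
open import Data.Fin using (Fin; _≟_)
open import Data.List using (List; []; _∷_; allFin; map)
open import Data.Bool.ListAction using (all; any)
open import Data.Nat.ListAction using (sum)
open import Data.List.Relation.Unary.All using (All)
open import Data.Product using (Σ; _×_)
open import Relation.Nullary using (¬_)
open import Relation.Nullary.Decidable using (⌊_⌋)
open import Relation.Binary.PropositionalEquality using (_≡_)

record Graph (n : ℕ) : Set where
  field
    adj     : Fin n → Fin n → Bool
    adj-refl : ∀ v → adj v v ≡ true
    adj-sym  : ∀ u v → adj u v ≡ adj v u
open Graph public

-- Vertex subsets (vertex sets of induced subgraphs) as Bool-valued predicates.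
Subset : ℕ → Set
Subset n = Fin n → Bool

module _ {n : ℕ} (G : Graph n) where

  allV : (Fin n → Bool) → Bool
  allV p = all p (allFin n)

  anyV : (Fin n → Bool) → Bool
  anyV p = any p (allFin n)

  card : Subset n → ℕ
  card S = sum (map (λ v → if S v then 1 else 0) (allFin n))

  nbhd : Subset n → Fin n → Subset n
  nbhd S v u = S u ∧ adj G v u

  subsetᵇ : Subset n → Subset n → Bool
  subsetᵇ A B = allV (λ u → not (A u) ∨ B u)

  strictSubsetᵇ : Subset n → Subset n → Bool
  strictSubsetᵇ A B = subsetᵇ A B ∧ not (subsetᵇ B A)

  strictCorner : Subset n → Subset n
  strictCorner S v =
    S v ∧ anyV (λ w → S w ∧ not ⌊ w ≟ v ⌋ ∧ strictSubsetᵇ (nbhd S v) (nbhd S w))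

  isClique : Subset n → Bool
  isClique S = allV (λ u → allV (λ v → not (S u ∧ S v) ∨ adj G u v))

  hasCorner : Subset n → Bool
  hasCorner S = anyV (strictCorner S)

  -- stage j = vertex set of G^(j+1) in the corner ranking procedure
  -- (once the procedure has stopped the value is frozen; irrelevant below)
  stage : ℕ → Subset n
  stage zero = λ _ → true
  stage (suc j) =
    if isClique (stage j) ∨ not (hasCorner (stage j))
    then stage j
    else (λ u → stage j u ∧ not (strictCorner (stage j) u))

  -- G is cop-win with corner rank α = suc a: the procedure runs through
  -- G^(1),…,G^(a) (each not a clique and having strict corners) and
  -- G^(a+1) is a clique.
  CopWinOfRank : ℕ → Set
  CopWinOfRank a =
    (isClique (stage a) ≡ true) ×
    (∀ j → j < a → (isClique (stage j) ≡ false) × (hasCorner (stage j) ≡ true))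

  -- (x_j, …, x_1): x_i = number of strict corners of G^(i), i ≤ j
  cornerCounts : ℕ → List ℕ
  cornerCounts zero = []
  cornerCounts (suc j) = card (strictCorner (stage j)) ∷ cornerCounts j

  -- rank cardinality vector (x_α, …, x_1) for corner rank α = suc a;
  -- vertices of rank α are those of the clique G^(α).
  rankCardVec : ℕ → List ℕ
  rankCardVec a = card (stage a) ∷ cornerCounts a

  -- type 0 (α = suc a): no vertex of rank α is adjacent to all vertices
  -- of G^(α-1)  (G^(α-1) = stage (pred a)).
  Type0 : ℕ → Set
  Type0 a = ¬ (Σ (Fin n) λ v → (stage a v ≡ true) ×
                 (∀ u → stage (pred a) u ≡ true → adj G v u ≡ true))

ZeroRealizable : List ℕ → Set
ZeroRealizable xs =
  All (1 ≤_) xs ×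
  Σ ℕ λ n → Σ (Graph (suc n)) λ G → Σ ℕ λ a →
    CopWinOfRank G a × Type0 G a × (rankCardVec G a ≡ xs)

module Submission where

-- Suppose G has corner rank 4 with stages S₁ ⊇ S₂ ⊇ S₃ ⊇ S₄, where Sᵢ₊₁ is
-- Sᵢ minus its strict corners Cᵢ, S₄ is a clique, C₁ = {z} and C₃ has two
-- elements.  Two facts about one corner-deletion step S → S' drive the
-- argument: a domination inside G[S'] that fails in G[S] is witnessed by a
-- deleted corner (cornerWitness), and following dominators inside G[S]
-- from any vertex reaches a survivor whose neighbourhood contains the
-- starting one (reachSurvivor).  Type 0 says every vertex of S₄ misses a
-- vertex of S₃, necessarily a corner; since only two corners exist this
-- forces: adjacent corners coincide, a vertex of S₄ sees at most one
-- corner and dominates any corner it sees, and it sees at least one.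
-- Finally the dominator of z leads to a "hub" x ∈ S₃ adjacent to all of
-- C₂; x can be neither a corner of S₃ nor a vertex of the clique S₄.

open import Defs
open import Data.Nat using (ℕ; zero; suc; _+_; _<_; _≤_; z≤n; s≤s)
open import Data.Nat.Properties
  using (suc-injective; +-mono-≤; ≤-refl; ≤-trans; ≤-reflexive; <-≤-trans; <⇒≱; +-mono-≤-<; +-monoˡ-≤; +-suc; +-identityʳ; m≤n+m)
open import Data.Bool using (Bool; true; false; _∧_; _∨_; not; if_then_else_; T; T?)
open import Data.Bool.Properties using (∧-conicalˡ; ∧-conicalʳ; T-≡)
open import Data.Nat.ListAction using (sum)
open import Data.Fin using (Fin; _≟_)
open import Data.List using (List; []; _∷_; allFin; map)
open import Data.List.Relation.Unary.All as All using (All)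
open import Data.List.Relation.Unary.All.Properties using (all⁺; all⁻; ¬All⇒Any¬)
open import Data.List.Relation.Unary.Any as Any using (here; there)
open import Data.List.Relation.Unary.Any.Properties using (any⁺; any⁻)
open import Data.List.Membership.Propositional using (_∈_; lose)
open import Data.List.Membership.Propositional.Properties using (∈-allFin)
open import Data.Product using (Σ; _×_; _,_; proj₁; proj₂)
open import Data.Sum using (_⊎_; inj₁; inj₂; [_,_]′)
open import Data.Unit using (tt)
open import Data.Empty using (⊥; ⊥-elim)
open import Function.Bundles using (Equivalence)
open import Relation.Nullary using (¬_; yes; no)
open import Relation.Nullary.Decidable using (⌊_⌋)
open import Relation.Binary.PropositionalEquality
  using (_≡_; _≢_; refl; sym; trans; cong; subst; subst₂)

open Equivalence using (to; from)

clash : ∀ {b} → b ≡ true → b ≡ false → ⊥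
clash refl ()

∧-intro : ∀ {a b} → a ≡ true → b ≡ true → a ∧ b ≡ true
∧-intro refl refl = refl

not-true : ∀ {b} → not b ≡ true → b ≡ false
not-true {false} _ = refl

¬T⇒false : ∀ {b} → ¬ T b → b ≡ false
¬T⇒false {false} _ = refl
¬T⇒false {true} ¬t = ⊥-elim (¬t tt)

implication-false : ∀ {a b} → not a ∨ b ≡ false → a ≡ true × b ≡ false
implication-false {true} b≡false = refl , b≡false
implication-false {false} ()

pigeonhole : ∀ {A : Set} {P : A → Set} {a b : A} → (∀ x → P x → x ≡ a ⊎ x ≡ b) →
             ∀ {x y z} → P x → P y → P z → x ≡ y ⊎ y ≡ z ⊎ x ≡ z
pigeonhole cover {x} {y} {z} px py pz with cover x px | cover y py | cover z pz
... | inj₁ refl | inj₁ refl | _         = inj₁ refl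
... | inj₂ refl | inj₂ refl | _         = inj₁ refl
... | _         | inj₁ refl | inj₁ refl = inj₂ (inj₁ refl)
... | _         | inj₂ refl | inj₂ refl = inj₂ (inj₁ refl)
... | inj₁ refl | _         | inj₁ refl = inj₂ (inj₂ refl)
... | inj₂ refl | _         | inj₂ refl = inj₂ (inj₂ refl)

indicator : Bool → ℕ
indicator b = if b then 1 else 0

-- Number of list entries satisfying a Boolean predicate; the cardinality
-- `card` of Defs is definitionally `tally` over the list of all vertices.
tally : ∀ {A : Set} → (A → Bool) → List A → ℕ
tally p xs = sum (map (λ v → indicator (p v)) xs)

module _ {A : Set} (p : A → Bool) where

  tally-zero : ∀ xs → tally p xs ≡ 0 → ∀ {v} → v ∈ xs → p v ≡ false
  tally-zero (x ∷ xs) h i with p x in px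
  tally-zero (x ∷ xs) h (here refl) | false = px
  tally-zero (x ∷ xs) h (there i)   | false = tally-zero xs h i

  tally-one : ∀ xs → tally p xs ≡ 1 →
              Σ A λ z → p z ≡ true × (∀ {v} → v ∈ xs → p v ≡ true → v ≡ z)
  tally-one (x ∷ xs) h with p x in px
  ... | true = x , px , λ { (here refl) _ → refl
                          ; (there i) pv → ⊥-elim (clash pv (tally-zero xs (suc-injective h) i)) }
  ... | false with tally-one xs h
  ...   | z , pz , only = z , pz , λ { (here refl) pv → ⊥-elim (clash pv px) ; (there i) pv → only i pv }

  tally-two : ∀ xs → tally p xs ≡ 2 →
              Σ A λ a → Σ A λ b → p a ≡ true × p b ≡ true ×
                (∀ {v} → v ∈ xs → p v ≡ true → v ≡ a ⊎ v ≡ b)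
  tally-two (x ∷ xs) h with p x in px
  ... | true with tally-one xs (suc-injective h)
  ...   | z , pz , only = x , z , px , pz , λ { (here refl) _ → inj₁ refl ; (there i) pv → inj₂ (only i pv) }
  tally-two (x ∷ xs) h | false with tally-two xs h
  ...   | a , b , pa , pb , cover =
    a , b , pa , pb , λ { (here refl) pv → ⊥-elim (clash pv px) ; (there i) pv → cover i pv }

indicator-mono : ∀ {a b} → (a ≡ true → b ≡ true) → indicator a ≤ indicator b
indicator-mono {false} _ = z≤n
indicator-mono {true} a⇒b rewrite a⇒b refl = ≤-refl

module _ {A : Set} {p q : A → Bool} (p⇒q : ∀ v → p v ≡ true → q v ≡ true) where

  tally-mono : ∀ xs → tally p xs ≤ tally q xs
  tally-mono [] = z≤n
  tally-mono (x ∷ xs) = +-mono-≤ (indicator-mono (p⇒q x)) (tally-mono xs)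

  tally-strict : ∀ xs {v} → v ∈ xs → q v ≡ true → p v ≡ false → tally p xs < tally q xs
  tally-strict (x ∷ xs) (here refl) qv pv rewrite qv | pv = s≤s (tally-mono xs)
  tally-strict (x ∷ xs) (there i) qv pv =
    +-mono-≤-< (indicator-mono (p⇒q x)) (tally-strict xs i qv pv)

-- Budget arithmetic for climbing: passing from b to a strictly larger c
-- spends one unit, and with no budget left no such step is possible.
budget-step : ∀ {a b c} f → a ≤ b + suc f → b < c → a ≤ c + f
budget-step {b = b} f a≤b+1+f b<c = ≤-trans a≤b+1+f (≤-trans (≤-reflexive (+-suc b f)) (+-monoˡ-≤ f b<c))

budget-empty : ∀ {a b c} → a ≤ b + 0 → b < c → c ≤ a → ⊥
budget-empty {a} {b} a≤b+0 b<c c≤a = <⇒≱ (<-≤-trans b<c c≤a) (subst (a ≤_) (+-identityʳ b) a≤b+0)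

module Domination {n : ℕ} (G : Graph n) where

  _⊆_ : Subset n → Subset n → Set
  P ⊆ Q = ∀ u → P u ≡ true → Q u ≡ true

  _⊊_ : Subset n → Subset n → Set
  P ⊊ Q = P ⊆ Q × Σ (Fin n) λ u → Q u ≡ true × P u ≡ false

  ⊊-asym : ∀ {P Q} → P ⊊ Q → ¬ (Q ⊊ P)
  ⊊-asym (_ , u , qu , pu) (Q⊆P , _) = clash (Q⊆P u qu) pu

  Dominates : Subset n → Fin n → Fin n → Set
  Dominates S w v = S w ≡ true × w ≢ v × nbhd G S v ⊊ nbhd G S w

  allV-sound : ∀ {p} → allV G p ≡ true → ∀ v → p v ≡ true
  allV-sound {p} h v = to T-≡ (All.lookup (all⁺ p (allFin n) (from T-≡ h)) (∈-allFin v))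

  allV-complete : ∀ {p} → (∀ v → p v ≡ true) → allV G p ≡ true
  allV-complete {p} h = to T-≡ (all⁻ p {allFin n} (All.tabulate λ {v} _ → from T-≡ (h v)))

  allV-false : ∀ {p} → allV G p ≡ false → Σ (Fin n) λ v → p v ≡ false
  allV-false {p} h with Any.satisfied (¬All⇒Any¬ (λ v → T? (p v)) (allFin n) notAll)
    where
    notAll : ¬ All (λ v → T (p v)) (allFin n)
    notAll everywhere = clash (to T-≡ (all⁻ p everywhere)) h
  ... | v , ¬pv = v , ¬T⇒false ¬pv

  anyV-sound : ∀ {p} → anyV G p ≡ true → Σ (Fin n) λ v → p v ≡ true
  anyV-sound {p} h with Any.satisfied (any⁻ p (allFin n) (from T-≡ h))
  ... | v , pv = v , to T-≡ pv

  anyV-complete : ∀ {p} v → p v ≡ true → anyV G p ≡ true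
  anyV-complete {p} v pv = to T-≡ (any⁺ p (lose (∈-allFin v) (from T-≡ pv)))

  subsetᵇ-sound : ∀ {P Q} → subsetᵇ G P Q ≡ true → P ⊆ Q
  subsetᵇ-sound {Q = Q} h u pu = subst (λ b → not b ∨ Q u ≡ true) pu (allV-sound h u)

  subsetᵇ-complete : ∀ {P Q} → P ⊆ Q → subsetᵇ G P Q ≡ true
  subsetᵇ-complete {P} {Q} P⊆Q = allV-complete pointwise
    where
    pointwise : ∀ u → not (P u) ∨ Q u ≡ true
    pointwise u with P u in pu
    ... | false = refl
    ... | true = P⊆Q u pu

  subsetᵇ-false : ∀ {P Q} → subsetᵇ G P Q ≡ false → Σ (Fin n) λ u → P u ≡ true × Q u ≡ false
  subsetᵇ-false h with allV-false h
  ... | u , fails = u , implication-false fails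

  counterexample : ∀ {P Q} → ¬ (P ⊆ Q) → Σ (Fin n) λ u → P u ≡ true × Q u ≡ false
  counterexample {P} {Q} P⊈Q with subsetᵇ G P Q in h
  ... | true = ⊥-elim (P⊈Q (subsetᵇ-sound h))
  ... | false = subsetᵇ-false h

  strictSubsetᵇ-sound : ∀ {P Q} → strictSubsetᵇ G P Q ≡ true → P ⊊ Q
  strictSubsetᵇ-sound h =
    subsetᵇ-sound (∧-conicalˡ _ _ h) , subsetᵇ-false (not-true (∧-conicalʳ _ _ h))

  strictSubsetᵇ-complete : ∀ {P Q} → P ⊊ Q → strictSubsetᵇ G P Q ≡ true
  strictSubsetᵇ-complete {P} {Q} (P⊆Q , u , qu , pu) =
    ∧-intro (subsetᵇ-complete P⊆Q) (cong not reverseFails)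
    where
    reverseFails : subsetᵇ G Q P ≡ false
    reverseFails with subsetᵇ G Q P in h
    ... | true = ⊥-elim (clash (subsetᵇ-sound {Q} {P} h u qu) pu)
    ... | false = refl

  distinct-sound : ∀ (w v : Fin n) → not ⌊ w ≟ v ⌋ ≡ true → w ≢ v
  distinct-sound w v h with w ≟ v
  distinct-sound w v () | yes _
  ... | no w≢v = w≢v

  distinct-complete : ∀ (w v : Fin n) → w ≢ v → not ⌊ w ≟ v ⌋ ≡ true
  distinct-complete w v w≢v with w ≟ v
  ... | yes w≡v = ⊥-elim (w≢v w≡v)
  ... | no _ = refl

  corner-sound : ∀ {S v} → strictCorner G S v ≡ true → Σ (Fin n) λ w → Dominates S w v
  corner-sound {S} {v} h with anyV-sound (∧-conicalʳ (S v) _ h)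
  ... | w , q = w , ∧-conicalˡ (S w) _ q ,
                distinct-sound w v (∧-conicalˡ (not ⌊ w ≟ v ⌋) _ distinctAndStrict) ,
                strictSubsetᵇ-sound (∧-conicalʳ (not ⌊ w ≟ v ⌋) _ distinctAndStrict)
    where
    distinctAndStrict = ∧-conicalʳ (S w) _ q

  corner-complete : ∀ {S v w} → S v ≡ true → Dominates S w v → strictCorner G S v ≡ true
  corner-complete {S} {v} {w} sv (sw , w≢v , N[v]⊊N[w]) =
    ∧-intro sv (anyV-complete w
      (∧-intro sw (∧-intro (distinct-complete w v w≢v) (strictSubsetᵇ-complete N[v]⊊N[w]))))

  corner-member : ∀ {S v} → strictCorner G S v ≡ true → S v ≡ true
  corner-member h = ∧-conicalˡ _ _ h

  clique-sound : ∀ {S} → isClique G S ≡ true → ∀ {u v} → S u ≡ true → S v ≡ true → adj G u v ≡ true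
  clique-sound h {u} {v} su sv =
    subst₂ (λ a b → not (a ∧ b) ∨ adj G u v ≡ true) su sv (allV-sound (allV-sound h u) v)

  nbhd-intro : ∀ {S v u} → S u ≡ true → adj G v u ≡ true → nbhd G S v u ≡ true
  nbhd-intro = ∧-intro

  nbhd-self : ∀ {S v} → S v ≡ true → nbhd G S v v ≡ true
  nbhd-self {S} {v} sv = nbhd-intro {S} sv (adj-refl G v)

  nbhd-member : ∀ {S v u} → nbhd G S v u ≡ true → S u ≡ true
  nbhd-member h = ∧-conicalˡ _ _ h

  nbhd-adj : ∀ {S v u} → nbhd G S v u ≡ true → adj G v u ≡ true
  nbhd-adj h = ∧-conicalʳ _ _ h

  nbhd-miss : ∀ {S v u} → S u ≡ true → adj G v u ≡ false → nbhd G S v u ≡ false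
  nbhd-miss {v = v} {u} su = subst (λ b → b ∧ adj G v u ≡ false) (sym su)

  nbhd-miss⁻ : ∀ {S v u} → S u ≡ true → nbhd G S v u ≡ false → adj G v u ≡ false
  nbhd-miss⁻ {v = v} {u} su = subst (λ b → b ∧ adj G v u ≡ false) su

  dominator-adjacent : ∀ {S v w} → S v ≡ true → Dominates S w v → adj G w v ≡ true
  dominator-adjacent {S} {v} sv (_ , _ , N[v]⊆N[w] , _) = nbhd-adj {S} (N[v]⊆N[w] v (nbhd-self {S} sv))

  card-one : ∀ {P} → card G P ≡ 1 → Σ (Fin n) λ z → P z ≡ true × (∀ v → P v ≡ true → v ≡ z)
  card-one {P} h with tally-one P (allFin n) h
  ... | z , pz , only = z , pz , λ v → only (∈-allFin v)

  card-two : ∀ {P} → card G P ≡ 2 →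
             Σ (Fin n) λ a → Σ (Fin n) λ b → P a ≡ true × P b ≡ true × (∀ v → P v ≡ true → v ≡ a ⊎ v ≡ b)
  card-two {P} h with tally-two P (allFin n) h
  ... | a , b , pa , pb , cover = a , b , pa , pb , λ v → cover (∈-allFin v)

  neighbourhood-grows : ∀ {S v w} → Dominates S w v → card G (nbhd G S v) < card G (nbhd G S w)
  neighbourhood-grows (_ , _ , N[v]⊆N[w] , u , wu , vu) =
    tally-strict N[v]⊆N[w] (allFin n) (∈-allFin u) wu vu

  neighbourhood-bounded : ∀ {S w} → card G (nbhd G S w) ≤ card G S
  neighbourhood-bounded {S} = tally-mono (λ _ → nbhd-member {S}) (allFin n)

module CornerRemoval {n : ℕ} (G : Graph n) (S S' : Subset n)
  (S'-def : ∀ u → S' u ≡ S u ∧ not (strictCorner G S u)) where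

  open Domination G

  C : Subset n
  C = strictCorner G S

  survivor-member : ∀ {u} → S' u ≡ true → S u ≡ true
  survivor-member {u} h = ∧-conicalˡ (S u) _ (trans (sym (S'-def u)) h)

  survivor-notCorner : ∀ {u} → S' u ≡ true → C u ≡ false
  survivor-notCorner {u} h = not-true (∧-conicalʳ (S u) _ (trans (sym (S'-def u)) h))

  survivor-intro : ∀ {u} → S u ≡ true → C u ≡ false → S' u ≡ true
  survivor-intro {u} su cu = trans (S'-def u) (∧-intro su (cong not cu))

  -- Specialisations to S, so that S need not be inferred.
  corner-inS : ∀ {u} → C u ≡ true → S u ≡ true
  corner-inS = corner-member {S}

  corner-dominated : ∀ {u} → C u ≡ true → Σ (Fin n) λ w → Dominates S w u
  corner-dominated = corner-sound {S}

  corner-or-survivor : ∀ {u} → S u ≡ true → C u ≡ true ⊎ S' u ≡ true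
  corner-or-survivor {u} su with C u in cu
  ... | true = inj₁ refl
  ... | false = inj₂ (survivor-intro su cu)

  domination-lifts : ∀ {v w} → (∀ y → C y ∧ adj G v y ≡ true → adj G w y ≡ true) →
                     Dominates S' w v → Dominates S w v
  domination-lifts {v} {w} corners-shared (s'w , w≢v , N'[v]⊆N'[w] , t , wt , vt) =
    survivor-member s'w , w≢v , N[v]⊆N[w] ,
    t , nbhd-intro {S} (survivor-member s't) (nbhd-adj {S'} wt) ,
        nbhd-miss {S} (survivor-member s't) (nbhd-miss⁻ {S'} s't vt)
    where
    s't : S' t ≡ true
    s't = nbhd-member {S'} wt
    N[v]⊆N[w] : nbhd G S v ⊆ nbhd G S w
    N[v]⊆N[w] u vu with corner-or-survivor (nbhd-member {S} vu)
    ... | inj₁ cu = nbhd-intro {S} (nbhd-member {S} vu) (corners-shared u (∧-intro cu (nbhd-adj {S} vu)))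
    ... | inj₂ s'u = nbhd-intro {S} (nbhd-member {S} vu)
                       (nbhd-adj {S'} (N'[v]⊆N'[w] u (nbhd-intro {S'} s'u (nbhd-adj {S} vu))))

  cornerWitness : ∀ {v w} → S' v ≡ true → Dominates S' w v →
                  Σ (Fin n) λ y → C y ≡ true × adj G v y ≡ true × adj G w y ≡ false
  cornerWitness {v} {w} s'v dom with counterexample notShared
    where
    notShared : ¬ (∀ y → C y ∧ adj G v y ≡ true → adj G w y ≡ true)
    notShared shared =
      clash (corner-complete (survivor-member s'v) (domination-lifts shared dom)) (survivor-notCorner s'v)
  ... | y , cv , wy = y , ∧-conicalˡ (C y) _ cv , ∧-conicalʳ (C y) _ cv , wy

  SurvivorAbove : Fin n → Set
  SurvivorAbove y = Σ (Fin n) λ u → S' u ≡ true × nbhd G S y ⊆ nbhd G S u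

  -- Climbing along dominators: each step strictly enlarges the
  -- neighbourhood, so a budget of |S| - |N[y]| steps suffices.
  climb : ∀ budget {y} → S y ≡ true → card G S ≤ card G (nbhd G S y) + budget → SurvivorAbove y
  climb budget {y} sy bound with C y in cy
  ... | false = y , survivor-intro sy cy , λ _ yu → yu
  ... | true = climbVia budget bound (corner-dominated cy)
    where
    climbVia : ∀ fuel → card G S ≤ card G (nbhd G S y) + fuel →
               Σ (Fin n) (λ w → Dominates S w y) → SurvivorAbove y
    climbVia zero bound (_ , dom) =
      ⊥-elim (budget-empty bound (neighbourhood-grows dom) (neighbourhood-bounded {S}))
    climbVia (suc fuel) bound (_ , dom@(sw , _ , N[y]⊆N[w] , _))
      with climb fuel sw (budget-step fuel bound (neighbourhood-grows dom))
    ... | u , s'u , N[w]⊆N[u] = u , s'u , λ x yx → N[w]⊆N[u] x (N[y]⊆N[w] x yx)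

  reachSurvivor : ∀ {y} → S y ≡ true → SurvivorAbove y
  reachSurvivor {y} sy = climb (card G S) sy (m≤n+m _ _)

module RankFour {n : ℕ} (G : Graph n) (S₁ S₂ S₃ S₄ : Subset n)
  (step₁ : ∀ u → S₂ u ≡ S₁ u ∧ not (strictCorner G S₁ u))
  (step₂ : ∀ u → S₃ u ≡ S₂ u ∧ not (strictCorner G S₂ u))
  (step₃ : ∀ u → S₄ u ≡ S₃ u ∧ not (strictCorner G S₃ u))
  (clique₄ : isClique G S₄ ≡ true)
  (type0 : ¬ (Σ (Fin n) λ v → (S₄ v ≡ true) × (∀ u → S₃ u ≡ true → adj G v u ≡ true)))
  (rank1-count : card G (strictCorner G S₁) ≡ 1)
  (rank3-count : card G (strictCorner G S₃) ≡ 2) where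

  open Domination G
  module R₁ = CornerRemoval G S₁ S₂ step₁
  module R₂ = CornerRemoval G S₂ S₃ step₂
  module R₃ = CornerRemoval G S₃ S₄ step₃

  C₁ C₂ C₃ : Subset n
  C₁ = R₁.C
  C₂ = R₂.C
  C₃ = R₃.C

  A : Fin n → Fin n → Bool
  A = adj G

  z : Fin n
  z = proj₁ (card-one rank1-count)

  z-corner : C₁ z ≡ true
  z-corner = proj₁ (proj₂ (card-one rank1-count))

  z-unique : ∀ v → C₁ v ≡ true → v ≡ z
  z-unique = proj₂ (proj₂ (card-one rank1-count))

  rank3 : Σ (Fin n) λ a → Σ (Fin n) λ b → C₃ a ≡ true × C₃ b ≡ true × (∀ v → C₃ v ≡ true → v ≡ a ⊎ v ≡ b)
  rank3 = card-two rank3-count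

  c₁ c₂ : Fin n
  c₁ = proj₁ rank3
  c₂ = proj₁ (proj₂ rank3)

  c₁-corner : C₃ c₁ ≡ true
  c₁-corner = proj₁ (proj₂ (proj₂ rank3))

  c₂-corner : C₃ c₂ ≡ true
  c₂-corner = proj₁ (proj₂ (proj₂ (proj₂ rank3)))

  cover : ∀ v → C₃ v ≡ true → v ≡ c₁ ⊎ v ≡ c₂
  cover = proj₂ (proj₂ (proj₂ (proj₂ rank3)))

  clique-adjacent : ∀ {u v} → S₄ u ≡ true → S₄ v ≡ true → A u v ≡ true
  clique-adjacent = clique-sound clique₄

  cliqueVertex-missesCorner : ∀ {v} → S₄ v ≡ true → Σ (Fin n) λ e → C₃ e ≡ true × A v e ≡ false
  cliqueVertex-missesCorner {v} s₄v with counterexample {S₃} {A v} (λ seesAll → type0 (v , s₄v , seesAll))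
  ... | u , s₃u , vu with R₃.corner-or-survivor s₃u
  ...   | inj₁ cu = u , cu , vu
  ...   | inj₂ s₄u = ⊥-elim (clash (clique-adjacent s₄v s₄u) vu)

  -- With only two corners, a vertex of S₄ sees at most one of them.
  cliqueVertex-seesOneCorner : ∀ {v d e} → S₄ v ≡ true → C₃ d ≡ true → C₃ e ≡ true →
                               A v d ≡ true → A v e ≡ true → d ≡ e
  cliqueVertex-seesOneCorner s₄v cd ce vd ve with cliqueVertex-missesCorner s₄v
  ... | m , cm , vm with pigeonhole cover cd ce cm
  ...   | inj₁ d≡e = d≡e
  ...   | inj₂ (inj₁ refl) = ⊥-elim (clash ve vm)
  ...   | inj₂ (inj₂ refl) = ⊥-elim (clash vd vm)

  neighbourCorner-dominates : ∀ {d e} → C₃ d ≡ true → C₃ e ≡ true → A d e ≡ true →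
                              d ≡ e ⊎ nbhd G S₃ d ⊊ nbhd G S₃ e
  neighbourCorner-dominates {e = e} cd ce de with R₃.corner-dominated cd
  ... | w , dom@(s₃w , w≢d , N[d]⊊N[w]) with R₃.corner-or-survivor s₃w
  ...   | inj₂ s₄w = inj₁ (cliqueVertex-seesOneCorner s₄w cd ce (dominator-adjacent (R₃.corner-inS cd) dom) we)
    where
    we : A w e ≡ true
    we = nbhd-adj {S₃} (proj₁ N[d]⊊N[w] e (nbhd-intro {S₃} (R₃.corner-inS ce) de))
  ...   | inj₁ cw with pigeonhole cover cd ce cw
  ...     | inj₁ d≡e = inj₁ d≡e
  ...     | inj₂ (inj₁ refl) = inj₂ N[d]⊊N[w]
  ...     | inj₂ (inj₂ refl) = ⊥-elim (w≢d refl)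

  adjacentCorners-equal : ∀ {d e} → C₃ d ≡ true → C₃ e ≡ true → A d e ≡ true → d ≡ e
  adjacentCorners-equal {d} {e} cd ce de
    with neighbourCorner-dominates cd ce de
       | neighbourCorner-dominates ce cd (trans (adj-sym G e d) de)
  ... | inj₁ d≡e | _ = d≡e
  ... | inj₂ _ | inj₁ e≡d = sym e≡d
  ... | inj₂ N[d]⊊N[e] | inj₂ N[e]⊊N[d] = ⊥-elim (⊊-asym N[d]⊊N[e] N[e]⊊N[d])

  cornerDominator-inClique : ∀ {d w} → C₃ d ≡ true → Dominates S₃ w d → S₄ w ≡ true
  cornerDominator-inClique cd dom@(s₃w , w≢d , _) with R₃.corner-or-survivor s₃w
  ... | inj₁ cw = ⊥-elim (w≢d (adjacentCorners-equal cw cd (dominator-adjacent (R₃.corner-inS cd) dom)))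
  ... | inj₂ s₄w = s₄w

  otherCorner : ∀ {d} → C₃ d ≡ true → Σ (Fin n) λ e → C₃ e ≡ true × e ≢ d
  otherCorner cd with R₃.corner-dominated cd
  ... | _ , dom with cliqueVertex-missesCorner (cornerDominator-inClique cd dom)
  ...   | e , ce , we = e , ce , λ { refl → clash (dominator-adjacent (R₃.corner-inS cd) dom) we }

  privateNeighbour-inClique : ∀ {d w t} → C₃ d ≡ true → Dominates S₃ w d →
                              nbhd G S₃ w t ≡ true → nbhd G S₃ d t ≡ false → S₄ t ≡ true
  privateNeighbour-inClique cd dom wt dt with R₃.corner-or-survivor (nbhd-member {S₃} wt)
  ... | inj₂ s₄t = s₄t
  ... | inj₁ ct with cliqueVertex-seesOneCorner (cornerDominator-inClique cd dom) cd ct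
                       (dominator-adjacent (R₃.corner-inS cd) dom) (nbhd-adj {S₃} wt)
  ...   | refl = ⊥-elim (clash (nbhd-self {S₃} (R₃.corner-inS cd)) dt)

  cliqueNeighbour-dominates : ∀ {x d} → S₄ x ≡ true → C₃ d ≡ true → A x d ≡ true → Dominates S₃ x d
  cliqueNeighbour-dominates {x} {d} s₄x cd xd with R₃.corner-dominated cd
  ... | w , dom@(_ , _ , _ , t , wt , dt) =
    R₃.survivor-member s₄x , x≢d , N[d]⊆N[x] ,
    t , nbhd-intro {S₃} (nbhd-member {S₃} wt) (clique-adjacent s₄x (privateNeighbour-inClique cd dom wt dt)) , dt
    where
    x≢d : x ≢ d
    x≢d refl = clash cd (R₃.survivor-notCorner s₄x)
    N[d]⊆N[x] : nbhd G S₃ d ⊆ nbhd G S₃ x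
    N[d]⊆N[x] u du with R₃.corner-or-survivor (nbhd-member {S₃} du)
    ... | inj₂ s₄u = nbhd-intro {S₃} (nbhd-member {S₃} du) (clique-adjacent s₄x s₄u)
    ... | inj₁ cu with adjacentCorners-equal cd cu (nbhd-adj {S₃} du)
    ...   | refl = nbhd-intro {S₃} (R₃.corner-inS cd) xd

  -- A vertex of S₄ sees some corner: otherwise the dominator of c₁
  -- would dominate it, making it a corner.
  cliqueVertex-seesCorner : ∀ {x} → S₄ x ≡ true → Σ (Fin n) λ d → C₃ d ≡ true × A x d ≡ true
  cliqueVertex-seesCorner {x} s₄x with A x c₁ in xc₁ | A x c₂ in xc₂
  ... | true | _ = c₁ , c₁-corner , xc₁
  ... | false | true = c₂ , c₂-corner , xc₂
  ... | false | false = ⊥-elim (clash (corner-complete {S₃} (R₃.survivor-member s₄x) dom) (R₃.survivor-notCorner s₄x))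
    where
    blind : ∀ d → C₃ d ≡ true → A x d ≡ false
    blind d cd with cover d cd
    ... | inj₁ refl = xc₁
    ... | inj₂ refl = xc₂
    s₃c₁ : S₃ c₁ ≡ true
    s₃c₁ = R₃.corner-inS c₁-corner
    w : Fin n
    w = proj₁ (R₃.corner-dominated c₁-corner)
    w-dom : Dominates S₃ w c₁
    w-dom = proj₂ (R₃.corner-dominated c₁-corner)
    s₄w : S₄ w ≡ true
    s₄w = cornerDominator-inClique c₁-corner w-dom
    wc₁ : A w c₁ ≡ true
    wc₁ = dominator-adjacent s₃c₁ w-dom
    N[x]⊆N[w] : nbhd G S₃ x ⊆ nbhd G S₃ w
    N[x]⊆N[w] u xu with R₃.corner-or-survivor (nbhd-member {S₃} xu)
    ... | inj₁ cu = ⊥-elim (clash (nbhd-adj {S₃} xu) (blind u cu))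
    ... | inj₂ s₄u = nbhd-intro {S₃} (nbhd-member {S₃} xu) (clique-adjacent s₄w s₄u)
    dom : Dominates S₃ w x
    dom = proj₁ w-dom , (λ { refl → clash wc₁ xc₁ }) , N[x]⊆N[w] ,
          c₁ , nbhd-intro {S₃} s₃c₁ wc₁ , nbhd-miss {S₃} s₃c₁ xc₁

  -- Every corner of rank 2 is adjacent to z: its domination in G[S₂] is
  -- witnessed by a corner of rank 1, which can only be z.
  rank2-seesZ : ∀ {y} → C₂ y ≡ true → A y z ≡ true
  rank2-seesZ cy with R₂.corner-dominated cy
  ... | _ , dom with R₁.cornerWitness (R₂.corner-inS cy) dom
  ...   | c , cc , yc , _ with z-unique c cc
  ...     | refl = yc

  -- Two vertices of S₃ adjacent to a common vertex of S₂ have a common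
  -- neighbour in S₃ (the survivor reached from that vertex).
  commonNeighbour : ∀ {y a b} → S₂ y ≡ true → S₃ a ≡ true → S₃ b ≡ true → A a y ≡ true → A b y ≡ true →
                    Σ (Fin n) λ u → S₃ u ≡ true × A u a ≡ true × A u b ≡ true
  commonNeighbour {y} s₂y s₃a s₃b ay by with R₂.reachSurvivor s₂y
  ... | u , s₃u , N[y]⊆N[u] = u , s₃u , reaches s₃a ay , reaches s₃b by
    where
    reaches : ∀ {v} → S₃ v ≡ true → A v y ≡ true → A u v ≡ true
    reaches {v} s₃v vy =
      nbhd-adj {S₂} (N[y]⊆N[u] v (nbhd-intro {S₂} (R₂.survivor-member s₃v) (trans (adj-sym G y v) vy)))

  Hub : Fin n → Set
  Hub x = S₃ x ≡ true × (∀ y → C₂ y ≡ true → A x y ≡ true)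

  -- The dominator w₀ of z survives to S₂ and sees all of C₂ (which lies in
  -- N[z]); the survivor reached from w₀ in S₃ is a hub.
  hub : Σ (Fin n) Hub
  hub with R₁.corner-dominated z-corner
  ... | w₀ , (s₁w₀ , w₀≢z , N[z]⊊N[w₀]) with R₂.reachSurvivor (R₁.survivor-intro s₁w₀ w₀-notCorner)
    where
    w₀-notCorner : C₁ w₀ ≡ false
    w₀-notCorner with C₁ w₀ in cw₀
    ... | true = ⊥-elim (w₀≢z (z-unique w₀ cw₀))
    ... | false = refl
  ...   | u , s₃u , N[w₀]⊆N[u] = u , s₃u , λ y cy → nbhd-adj {S₂} (N[w₀]⊆N[u] y (w₀-sees cy))
    where
    w₀-sees : ∀ {y} → C₂ y ≡ true → nbhd G S₂ w₀ y ≡ true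
    w₀-sees {y} cy = nbhd-intro {S₂} (R₂.corner-inS cy)
      (nbhd-adj {S₁} (proj₁ N[z]⊊N[w₀] y
        (nbhd-intro {S₁} (R₁.survivor-member (R₂.corner-inS cy)) (trans (adj-sym G z y) (rank2-seesZ cy)))))

  noCommonNeighbour : ∀ {d e u} → C₃ d ≡ true → C₃ e ≡ true → d ≢ e →
                      S₃ u ≡ true → A u d ≡ true → A u e ≡ true → ⊥
  noCommonNeighbour cd ce d≢e s₃u ud ue with R₃.corner-or-survivor s₃u
  ... | inj₁ cu = d≢e (trans (sym (adjacentCorners-equal cu cd ud)) (adjacentCorners-equal cu ce ue))
  ... | inj₂ s₄u = d≢e (cliqueVertex-seesOneCorner s₄u cd ce ud ue)

  -- A hub is not a corner of rank 3: the other corner e is dominated,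
  -- witnessed by some y ∈ C₂ adjacent to e, so the hub and e would have a
  -- common neighbour in S₃.
  hub-notCorner : ∀ {x} → Hub x → C₃ x ≡ true → ⊥
  hub-notCorner (s₃x , sees) cx =
    let (e , ce , e≢x) = otherCorner cx
        (_ , dom) = R₃.corner-dominated ce
        (y , cy , ey , _) = R₂.cornerWitness (R₃.corner-inS ce) dom
        (u , s₃u , ux , ue) = commonNeighbour (R₂.corner-inS cy) s₃x (R₃.corner-inS ce) (sees y cy) ey
    in noCommonNeighbour cx ce (λ x≡e → e≢x (sym x≡e)) s₃u ux ue

  -- A hub is not in S₄: it would dominate a corner d of rank 3, and that
  -- domination is witnessed by a corner of rank 2 the hub does not see.
  hub-notInClique : ∀ {x} → Hub x → S₄ x ≡ true → ⊥
  hub-notInClique (_ , sees) s₄x =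
    let (d , cd , xd) = cliqueVertex-seesCorner s₄x
        (y , cy , _ , xy) = R₂.cornerWitness (R₃.corner-inS cd) (cliqueNeighbour-dominates s₄x cd xd)
    in clash (sees y cy) xy

  impossible : ⊥
  impossible =
    let (x , hx) = hub
    in [ hub-notCorner hx , hub-notInClique hx ]′ (R₃.corner-or-survivor (proj₁ hx))

stage-step : ∀ {n} (G : Graph n) {a} → CopWinOfRank G a → ∀ j → j < a →
             ∀ u → stage G (suc j) u ≡ stage G j u ∧ not (strictCorner G (stage G j) u)
stage-step G (_ , running) j j<a u with running j j<a
... | notClique , hasCorners rewrite notClique | hasCorners = refl

second-and-fourth : ∀ {a b c d a′ b′ c′ d′ : ℕ} →
                    a ∷ b ∷ c ∷ d ∷ [] ≡ a′ ∷ b′ ∷ c′ ∷ d′ ∷ [] → b ≡ b′ × d ≡ d′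
second-and-fourth refl = refl , refl

-- Only corner rank 4 fits a vector of length 4; there the rank-four
-- configuration applies with x₁ = 1 and x₃ = 2.
theorem3p27 : (m k : ℕ) → 1 ≤ m → 1 ≤ k → ¬ ZeroRealizable (m ∷ 2 ∷ k ∷ 1 ∷ [])
theorem3p27 m k _ _ (_ , n , G , 0 , _ , _ , ())
theorem3p27 m k _ _ (_ , n , G , 1 , _ , _ , ())
theorem3p27 m k _ _ (_ , n , G , 2 , _ , _ , ())
theorem3p27 m k _ _ (_ , n , G , suc (suc (suc (suc a))) , _ , _ , ())
theorem3p27 m k _ _ (_ , n , G , 3 , copWin , type0 , vector) =
  RankFour.impossible G (stage G 0) (stage G 1) (stage G 2) (stage G 3)
    (stage-step G copWin 0 (s≤s z≤n))
    (stage-step G copWin 1 (s≤s (s≤s z≤n)))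
    (stage-step G copWin 2 (s≤s (s≤s (s≤s z≤n))))
    (proj₁ copWin) type0
    (proj₂ (second-and-fourth vector)) (proj₁ (second-and-fourth vector))
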